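{- Let $Y$ be a set of symbols, let $P,Q,R \subseteq \mathbb{Q}[Y]$ be finite, and let \[ F = \Big(\bigwedge_{p\in P} 0\le p\Big)\land\Big(\bigwedge_{q\in Q}\lnot(0\le q)\Big)\land\Big(\bigwedge_{r\in R}\lnot(0=r)\Big) \] be a ground formula over $\sigma_{or}(Y)$. Let $C$ be the least regular cone in $\mathbb{Q}[Y]$ that contains $P$. If $F$ is satisfiable modulo $\mathbf{LRR}$, then $C = \mathrm{Cn}_Y(F)$.
   Context: $\mathrm{Cn}_Y(F) = \{p \in \mathbb{Q}[Y] : F \models_{\mathbf{LRR}} 0 \le p\}$. Atoms with rational coefficients abbreviate $\sigma_{or}(Y)$-atoms by clearing denominators, where $\sigma_{or}$ has $+,\cdot,0,1,=,\le$. $\mathbf{LRR}$ is the $\sigma_{or}$-theory axiomatized by: the commutative ring axioms; reflexivity, transitivity and antisymmetry of $\le$; $\forall x,y,z\,(x\le y\Rightarrow x+z\le y+z)$; $0\le1\land 0\ne1$; for each integer $n\ge1$, $\exists x\,(x+\dots+x=1)$ ($n$ summands); for each integer $n\ge1$, $\forall x\,(0\le x+\dots+x\Rightarrow 0\le x)$ ($n$ summands). A cone contains $0$ and is closed under addition and multiplication by non-negative rationals; it is regular if it contains $1$ and its set of additive units $\{p: p, -p \in C\}$ is an ideal of $\mathbb{Q}[Y]$. -}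

module Defs where

open import Level using (Level; 0ℓ) renaming (suc to lsuc)
open import Data.Nat using (ℕ; zero; suc)
open import Data.Integer using (ℤ; +_; -[1+_])
open import Data.Rational as ℚ using (ℚ; 0ℚ; 1ℚ; -_; ↥_; ↧ₙ_)
open import Data.List using (List)
open import Data.List.Relation.Unary.All using (All)
open import Data.List.Membership.Propositional using (_∈_)
open import Data.Product using (Σ; _×_; proj₁)
open import Relation.Nullary using (¬_)
open import Relation.Binary.Core using (Rel)
open import Relation.Binary.Structures using (IsEquivalence)

-- ℚ[Y]: the polynomial ring over ℚ in the symbols Y, presented as the
-- free commutative ℚ-algebra on Y: terms modulo the congruence _≈ₚ_
-- generated by the commutative-ring axioms and the requirement that
-- the constants form a copy of ℚ (con is a ring homomorphism).

infixl 6 _⊕_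
infixl 7 _⊗_

data Poly (Y : Set) : Set where
  con : ℚ → Poly Y
  var : Y → Poly Y
  _⊕_ : Poly Y → Poly Y → Poly Y
  _⊗_ : Poly Y → Poly Y → Poly Y

⊝_ : {Y : Set} → Poly Y → Poly Y
⊝ p = con (- 1ℚ) ⊗ p

infix 4 _≈ₚ_
data _≈ₚ_ {Y : Set} : Poly Y → Poly Y → Set where
  ≈-refl  : ∀ {p} → p ≈ₚ p
  ≈-sym   : ∀ {p q} → p ≈ₚ q → q ≈ₚ p
  ≈-trans : ∀ {p q r} → p ≈ₚ q → q ≈ₚ r → p ≈ₚ r
  ⊕-congₚ  : ∀ {p p′ q q′} → p ≈ₚ p′ → q ≈ₚ q′ → p ⊕ q ≈ₚ p′ ⊕ q′
  ⊗-congₚ  : ∀ {p p′ q q′} → p ≈ₚ p′ → q ≈ₚ q′ → p ⊗ q ≈ₚ p′ ⊗ q′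
  ⊕-assocₚ : ∀ p q r → (p ⊕ q) ⊕ r ≈ₚ p ⊕ (q ⊕ r)
  ⊕-commₚ  : ∀ p q → p ⊕ q ≈ₚ q ⊕ p
  ⊕-idʳₚ   : ∀ p → p ⊕ con 0ℚ ≈ₚ p
  ⊕-invʳₚ  : ∀ p → p ⊕ (⊝ p) ≈ₚ con 0ℚ
  ⊗-assocₚ : ∀ p q r → (p ⊗ q) ⊗ r ≈ₚ p ⊗ (q ⊗ r)
  ⊗-commₚ  : ∀ p q → p ⊗ q ≈ₚ q ⊗ p
  ⊗-idʳₚ   : ∀ p → p ⊗ con 1ℚ ≈ₚ p
  distribʳₚ : ∀ p q r → (p ⊕ q) ⊗ r ≈ₚ (p ⊗ r) ⊕ (q ⊗ r)
  con-+   : ∀ a b → con (a ℚ.+ b) ≈ₚ con a ⊕ con b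
  con-*   : ∀ a b → con (a ℚ.* b) ≈ₚ con a ⊗ con b

Pred : Set → Set₁
Pred Y = Poly Y → Set

Respects : {Y : Set} → Pred Y → Set
Respects C = ∀ {p q} → p ≈ₚ q → C p → C q

_⊆_ : {Y : Set} → Pred Y → Pred Y → Set
C ⊆ D = ∀ p → C p → D p

record IsIdeal {Y : Set} (I : Pred Y) : Set where
  field
    respects : Respects I
    zero∈    : I (con 0ℚ)
    +-closed : ∀ p q → I p → I q → I (p ⊕ q)
    *-closed : ∀ r p → I p → I (r ⊗ p)

record IsCone {Y : Set} (C : Pred Y) : Set where
  field
    respects : Respects C
    zero∈    : C (con 0ℚ)
    +-closed : ∀ p q → C p → C q → C (p ⊕ q)
    scale    : ∀ (a : ℚ) p → 0ℚ ℚ.≤ a → C p → C (con a ⊗ p)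

Units : {Y : Set} → Pred Y → Pred Y
Units C p = C p × C (⊝ p)

record IsRegularCone {Y : Set} (C : Pred Y) : Set where
  field
    isCone      : IsCone C
    one∈        : C (con 1ℚ)
    units-ideal : IsIdeal (Units C)

record IsLeastRegularConeContaining {Y : Set} (P : List (Poly Y)) (C : Pred Y) : Set₁ where
  field
    regular : IsRegularCone C
    contains : ∀ p → p ∈ P → C p
    least   : ∀ (D : Pred Y) → IsRegularCone D → (∀ p → p ∈ P → D p) → C ⊆ D

-- Models of LRR (σ_or = {+, ·, 0, 1, =, ≤}).  The equality symbol is
-- interpreted by a congruence _≈_ (setoid semantics).

-- x + ... + x with (suc k) summands
rep : {A : Set} → (A → A → A) → ℕ → A → A
rep _+_ zero    x = x
rep _+_ (suc k) x = x + rep _+_ k x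

record LRRModel : Set₁ where
  infixl 6 _+_
  infixl 7 _*_
  infix 4 _≈_ _≤_
  field
    Carrier : Set
    _≈_     : Rel Carrier 0ℓ
    _+_ _*_ : Carrier → Carrier → Carrier
    0# 1#   : Carrier
    _≤_     : Rel Carrier 0ℓ
    isEquivalence : IsEquivalence _≈_
    +-cong  : ∀ {x x′ y y′} → x ≈ x′ → y ≈ y′ → x + y ≈ x′ + y′
    *-cong  : ∀ {x x′ y y′} → x ≈ x′ → y ≈ y′ → x * y ≈ x′ * y′
    ≤-resp  : ∀ {x x′ y y′} → x ≈ x′ → y ≈ y′ → x ≤ y → x′ ≤ y′
    +-assoc : ∀ x y z → (x + y) + z ≈ x + (y + z)
    +-comm  : ∀ x y → x + y ≈ y + x
    +-idʳ   : ∀ x → x + 0# ≈ x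
    +-inv   : ∀ x → Σ Carrier (λ y → x + y ≈ 0#)
    *-assoc : ∀ x y z → (x * y) * z ≈ x * (y * z)
    *-comm  : ∀ x y → x * y ≈ y * x
    *-idʳ   : ∀ x → x * 1# ≈ x
    distribʳ : ∀ x y z → (x + y) * z ≈ (x * z) + (y * z)
    ≤-refl    : ∀ x → x ≤ x
    ≤-trans   : ∀ x y z → x ≤ y → y ≤ z → x ≤ z
    ≤-antisym : ∀ x y → x ≤ y → y ≤ x → x ≈ y
    ≤-+       : ∀ x y z → x ≤ y → x + z ≤ y + z
    0≤1       : 0# ≤ 1#
    0≉1       : ¬ (0# ≈ 1#)
    -- for each n = suc k ≥ 1
    divisible : ∀ k → Σ Carrier (λ x → rep _+_ k x ≈ 1#)
    torsion   : ∀ k x → 0# ≤ rep _+_ k x → 0# ≤ x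

module Eval (M : LRRModel) where
  open LRRModel M

  neg : Carrier → Carrier
  neg x = proj₁ (+-inv x)

  nat : ℕ → Carrier
  nat zero    = 0#
  nat (suc n) = 1# + nat n

  int : ℤ → Carrier
  int (+ n)      = nat n
  int -[1+ n ]   = neg (nat (suc n))

  -- the (unique) x with (suc k)·x = 1
  inv : ℕ → Carrier
  inv zero    = 0#
  inv (suc k) = proj₁ (divisible k)

  rat : ℚ → Carrier
  rat q = int (↥ q) * inv (↧ₙ q)

  ⟦_⟧ : {Y : Set} → Poly Y → (Y → Carrier) → Carrier
  ⟦ con a ⟧ ρ = rat a
  ⟦ var y ⟧ ρ = ρ y
  ⟦ p ⊕ q ⟧ ρ = ⟦ p ⟧ ρ + ⟦ q ⟧ ρ
  ⟦ p ⊗ q ⟧ ρ = ⟦ p ⟧ ρ * ⟦ q ⟧ ρ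

record Formula (Y : Set) : Set where
  constructor formula
  field
    pos    : List (Poly Y)
    notLe  : List (Poly Y)
    notEq  : List (Poly Y)

Sat : {Y : Set} → (M : LRRModel) → (Y → LRRModel.Carrier M) → Formula Y → Set
Sat M ρ (formula P Q R) =
  All (λ p → 0# ≤ ⟦ p ⟧ ρ) P ×
  All (λ q → ¬ (0# ≤ ⟦ q ⟧ ρ)) Q ×
  All (λ r → ¬ (0# ≈ ⟦ r ⟧ ρ)) R
  where open LRRModel M
        open Eval M

Satisfiable : {Y : Set} → Formula Y → Set₁
Satisfiable {Y} F = Σ LRRModel (λ M → Σ (Y → LRRModel.Carrier M) (λ ρ → Sat M ρ F))

_⊨0≤_ : {Y : Set} → Formula Y → Poly Y → Set₁
F ⊨0≤ p = ∀ (M : LRRModel) ρ → Sat M ρ F → LRRModel._≤_ M (LRRModel.0# M) (Eval.⟦_⟧ M p ρ)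

Cn : {Y : Set} → Formula Y → Poly Y → Set₁
Cn F p = F ⊨0≤ p

module Submission where

-- If ρ satisfies F in a model M, the polynomials that are non-negative at ρ form a regular
-- cone containing P (its units are the polynomials vanishing at ρ, an ideal), hence contain C.
-- This needs evaluation to respect the equations of ℚ[Y]; divisibility and torsion-freeness
-- make ℚ act on M, the constant q denoting the unique x with (↧ q)·x = ↥ q.
-- Conversely, a regular cone C with -1 ∉ C makes ℚ[Y] itself a model of LRR, ordered by
-- x ≤ y iff y - x ∈ C, in which 0 ≤ p holds at the identity assignment exactly when p ∈ C.
-- Given a model of F, that assignment satisfies F: C is non-negative and its units vanish in
-- the given model (which also yields -1 ∉ C), so the negated conjuncts cannot fail.
-- Hence every p with F ⊨ 0 ≤ p lies in C.

open import Defs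
open import Level using (0ℓ)
open import Algebra.Bundles using (CommutativeRing)
open import Algebra.Core using (Op₁; Op₂)
open import Algebra.Structures using (IsCommutativeRing)
import Algebra.Solver.Ring.AlmostCommutativeRing as ACR
open import Data.Nat as ℕ using (ℕ; zero; suc)
open import Data.Integer as ℤ using (ℤ; +_; -[1+_]; _⊖_)
import Data.Integer.Properties as ℤ
open import Data.Integer.Tactic.RingSolver using (solve-∀)
open import Data.Rational as ℚ using (ℚ; mkℚ; 0ℚ; 1ℚ; ↥_; ↧_)
open import Data.Rational.Literals using (fromℤ)
import Data.Rational.Properties as ℚ
import Data.Rational.Unnormalised as ℚᵘ
import Data.Rational.Unnormalised.Properties as ℚᵘ
import Data.Maybe as Maybe
open Maybe using (Maybe)
open import Data.Product using (_,_; _×_; proj₂; map)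
open import Data.List using (List)
open import Data.List.Relation.Unary.All as All using (All)
open import Relation.Binary.Bundles using (Setoid)
open import Relation.Binary.Core using (Rel)
open import Relation.Binary.Structures using (IsEquivalence)
open import Relation.Binary.Consequences using (dec⇒weaklyDec)
open import Relation.Binary.PropositionalEquality as ≡ using (_≡_)
open import Relation.Nullary using (¬_)

module _ {A : Set} (_≈_ : Rel A 0ℓ) where
  open import Algebra.Definitions _≈_

  record IsCommutativeRingʳ (_+_ _*_ : Op₂ A) (-_ : Op₁ A) (0# 1# : A) : Set where
    field
      isEquivalence : IsEquivalence _≈_
      +-cong        : Congruent₂ _+_
      *-cong        : Congruent₂ _*_
      +-assoc       : Associative _+_
      +-comm        : Commutative _+_
      +-identityʳ   : RightIdentity 0# _+_
      -‿inverseʳ    : RightInverse 0# -_ _+_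
      *-assoc       : Associative _*_
      *-comm        : Commutative _*_
      *-identityʳ   : RightIdentity 1# _*_
      distribʳ      : _*_ DistributesOverʳ _+_

    private
      S : Setoid 0ℓ 0ℓ
      S = record { isEquivalence = isEquivalence }
      open IsEquivalence isEquivalence
      open import Algebra.Consequences.Setoid S

      +-identity : Identity 0# _+_
      +-identity = comm∧idʳ⇒id +-comm +-identityʳ

      -‿cong : Congruent₁ -_
      -‿cong {x} {y} x≈y = assoc∧id∧invʳ⇒invˡ-unique +-cong +-assoc +-identity -‿inverseʳ (- x) y
        (trans (+-cong refl (sym x≈y)) (comm∧invʳ⇒invˡ +-comm -‿inverseʳ x))

    isCommutativeRing : IsCommutativeRing _≈_ _+_ _*_ -_ 0# 1#
    isCommutativeRing = record
      { isRing = record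
        { +-isAbelianGroup = record
          { isGroup = record
            { isMonoid = record
              { isSemigroup = record
                { isMagma = record { isEquivalence = isEquivalence ; ∙-cong = +-cong }
                ; assoc = +-assoc }
              ; identity = +-identity }
            ; inverse = comm∧invʳ⇒inv +-comm -‿inverseʳ
            ; ⁻¹-cong = -‿cong }
          ; comm = +-comm }
        ; *-cong = *-cong
        ; *-assoc = *-assoc
        ; *-identity = comm∧idʳ⇒id *-comm *-identityʳ
        ; distrib = comm∧distrʳ⇒distr +-cong *-comm distribʳ }
      ; *-comm = *-comm }

module IntegerCast (R : CommutativeRing 0ℓ 0ℓ) where
  open CommutativeRing R
  open import Algebra.Properties.Ring ring using (-‿involutive; -0#≈0#; -‿distribˡ-*; -‿distribʳ-*)
  open import Algebra.Properties.AbelianGroup +-abelianGroup using (⁻¹-∙-comm)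
  open import Algebra.Properties.CommutativeSemigroup +-commutativeSemigroup using (interchange)
  import Algebra.Properties.Semiring.Mult semiring as Mult
  open import Relation.Binary.Reasoning.Setoid setoid

  ι : ℤ → Carrier
  ι (+ n)    = n Mult.× 1#
  ι -[1+ n ] = - (suc n Mult.× 1#)

  ι-neg : ∀ z → ι (ℤ.- z) ≈ - ι z
  ι-neg (+ zero)  = sym -0#≈0#
  ι-neg (+ suc n) = refl
  ι-neg -[1+ n ]  = sym (-‿involutive _)

  private
    1+-cancel : ∀ a b → (1# + a) - (1# + b) ≈ a - b
    1+-cancel a b = begin
      (1# + a) - (1# + b)     ≈⟨ +-congˡ (⁻¹-∙-comm 1# b) ⟨
      (1# + a) + (- 1# - b)   ≈⟨ interchange 1# a (- 1#) (- b) ⟩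
      (1# - 1#) + (a - b)     ≈⟨ +-congʳ (-‿inverseʳ 1#) ⟩
      0# + (a - b)            ≈⟨ +-identityˡ _ ⟩
      a - b                   ∎

  ι-⊖ : ∀ m n → ι (m ⊖ n) ≈ m Mult.× 1# - n Mult.× 1#
  ι-⊖ m       zero    = sym (trans (+-congˡ -0#≈0#) (+-identityʳ _))
  ι-⊖ zero    (suc n) = sym (+-identityˡ _)
  ι-⊖ (suc m) (suc n) = begin
    ι (suc m ⊖ suc n)                  ≡⟨ ≡.cong ι (ℤ.[1+m]⊖[1+n]≡m⊖n m n) ⟩
    ι (m ⊖ n)                          ≈⟨ ι-⊖ m n ⟩
    m Mult.× 1# - n Mult.× 1#          ≈⟨ 1+-cancel _ _ ⟨
    suc m Mult.× 1# - suc n Mult.× 1#  ∎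

  ι-+ : ∀ i j → ι (i ℤ.+ j) ≈ ι i + ι j
  ι-+ (+ m)    (+ n)    = Mult.×-homo-+ 1# m n
  ι-+ (+ m)    -[1+ n ] = ι-⊖ m (suc n)
  ι-+ -[1+ m ] (+ n)    = trans (ι-⊖ n (suc m)) (+-comm _ _)
  ι-+ -[1+ m ] -[1+ n ] = begin
    ι (-[1+ m ] ℤ.+ -[1+ n ])     ≡⟨ ≡.cong ι (ℤ.neg-distrib-+ (+ suc m) (+ suc n)) ⟨
    ι (ℤ.- (+ suc m ℤ.+ + suc n))  ≈⟨ ι-neg (+ suc m ℤ.+ + suc n) ⟩
    - ι (+ suc m ℤ.+ + suc n)      ≈⟨ -‿cong (ι-+ (+ suc m) (+ suc n)) ⟩
    - (ι (+ suc m) + ι (+ suc n))  ≈⟨ ⁻¹-∙-comm _ _ ⟨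
    ι -[1+ m ] + ι -[1+ n ]        ∎

  private
    ι-*ʳ : ∀ m j → ι (+ m ℤ.* j) ≈ ι (+ m) * ι j
    ι-*ʳ m (+ n)    = trans (reflexive (≡.cong ι (≡.sym (ℤ.pos-* m n)))) (Mult.×1-homo-* m n)
    ι-*ʳ m -[1+ n ] = begin
      ι (+ m ℤ.* -[1+ n ])       ≡⟨ ≡.cong ι (ℤ.neg-distribʳ-* (+ m) (+ suc n)) ⟨
      ι (ℤ.- (+ m ℤ.* + suc n))  ≈⟨ ι-neg (+ m ℤ.* + suc n) ⟩
      - ι (+ m ℤ.* + suc n)      ≈⟨ -‿cong (ι-*ʳ m (+ suc n)) ⟩
      - (ι (+ m) * ι (+ suc n))  ≈⟨ -‿distribʳ-* _ _ ⟩
      ι (+ m) * ι -[1+ n ]       ∎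

  ι-* : ∀ i j → ι (i ℤ.* j) ≈ ι i * ι j
  ι-* (+ m)    j = ι-*ʳ m j
  ι-* -[1+ m ] j = begin
    ι (-[1+ m ] ℤ.* j)       ≡⟨ ≡.cong ι (ℤ.neg-distribˡ-* (+ suc m) j) ⟨
    ι (ℤ.- (+ suc m ℤ.* j))  ≈⟨ ι-neg (+ suc m ℤ.* j) ⟩
    - ι (+ suc m ℤ.* j)      ≈⟨ -‿cong (ι-*ʳ (suc m) j) ⟩
    - (ι (+ suc m) * ι j)    ≈⟨ -‿distribˡ-* _ _ ⟩
    ι -[1+ m ] * ι j         ∎

  ι-homomorphism : ACR._-Raw-AlmostCommutative⟶_ ℤ.+-*-rawRing (ACR.fromCommutativeRing R)
  ι-homomorphism = record
    { ⟦_⟧ = ι ; +-homo = ι-+ ; *-homo = ι-* ; -‿homo = ι-neg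
    ; 0-homo = refl ; 1-homo = +-identityʳ 1# }

  ι-≟ : ∀ i j → Maybe (ι i ≈ ι j)
  ι-≟ i j = Maybe.map (λ { ≡.refl → refl }) (dec⇒weaklyDec ℤ._≟_ i j)

  open import Algebra.Solver.Ring ℤ.+-*-rawRing (ACR.fromCommutativeRing R) ι-homomorphism ι-≟ public
    using (solve; _:=_; _:+_; _:*_; :-_; _:-_)
    renaming (con to :c)

  ι-suc-* : ∀ n x → ι (+ suc n) * x ≈ x + ι (+ n) * x
  ι-suc-* n x = trans (distribʳ x 1# (n Mult.× 1#)) (+-congʳ (*-identityˡ x))

  rep-ι : ∀ k x → rep _+_ k x ≈ ι (+ suc k) * x
  rep-ι zero    x = solve 1 (λ x → x := :c (+ 1) :* x) refl x
  rep-ι (suc k) x = trans (+-congˡ (rep-ι k x)) (sym (ι-suc-* (suc k) x))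

fromℤ-suc : ∀ n → 1ℚ ℚ.+ fromℤ (+ n) ≡ fromℤ (+ suc n)
fromℤ-suc n = ℚ.toℚᵘ-injective (ℚᵘ.≃-trans (ℚ.toℚᵘ-homo-+ 1ℚ (fromℤ (+ n))) (ℚᵘ.*≡* (eq (+ n))))
  where
  eq : ∀ x → (ℤ.1ℤ ℤ.* ℤ.1ℤ ℤ.+ x ℤ.* ℤ.1ℤ) ℤ.* ℤ.1ℤ ≡ (ℤ.1ℤ ℤ.+ x) ℤ.* ℤ.1ℤ
  eq = solve-∀

-1*fromℤ : ∀ n → ℚ.- 1ℚ ℚ.* fromℤ (+ suc n) ≡ fromℤ -[1+ n ]
-1*fromℤ n = ≡.trans (≡.sym (ℚ.neg-distribˡ-* 1ℚ (fromℤ (+ suc n)))) (≡.cong ℚ.-_ (ℚ.*-identityˡ (fromℤ (+ suc n))))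

fromℤ-↧ : ∀ q → fromℤ (↧ q) ℚ.* q ≡ fromℤ (↥ q)
fromℤ-↧ q@(mkℚ n d _) = ℚ.toℚᵘ-injective (ℚᵘ.≃-trans (ℚ.toℚᵘ-homo-* (fromℤ (↧ q)) q) (ℚᵘ.*≡* (eq n (+ suc d))))
  where
  eq : ∀ n d → (d ℤ.* n) ℤ.* ℤ.1ℤ ≡ n ℤ.* (ℤ.1ℤ ℤ.* d)
  eq = solve-∀

module LRRModelTheory (M : LRRModel) where
  open LRRModel M
  open Eval M

  commutativeRing : CommutativeRing 0ℓ 0ℓ
  commutativeRing = record
    { Carrier = Carrier ; _≈_ = _≈_ ; _+_ = _+_ ; _*_ = _*_ ; -_ = neg ; 0# = 0# ; 1# = 1#
    ; isCommutativeRing = IsCommutativeRingʳ.isCommutativeRing {_≈_ = _≈_} (record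
      { isEquivalence = isEquivalence ; +-cong = +-cong ; *-cong = *-cong
      ; +-assoc = +-assoc ; +-comm = +-comm ; +-identityʳ = +-idʳ ; -‿inverseʳ = λ x → proj₂ (+-inv x)
      ; *-assoc = *-assoc ; *-comm = *-comm ; *-identityʳ = *-idʳ
      ; distribʳ = λ x y z → distribʳ y z x }) }

  open CommutativeRing commutativeRing public
    using (-_; _-_; setoid; refl; sym; trans; +-identityˡ; zeroʳ; -‿cong; -‿inverseˡ;
           +-congˡ; *-congˡ; *-congʳ)
  open IntegerCast commutativeRing public
  open import Algebra.Properties.Ring (CommutativeRing.ring commutativeRing)
    using (-0#≈0#; -‿distribʳ-*; x[y-z]≈xy-xz)
  open import Algebra.Properties.Group (CommutativeRing.+-group commutativeRing)
    using (x∙y⁻¹≈ε⇒x≈y; x≈y⇒x∙y⁻¹≈ε)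
  open import Relation.Binary.Reasoning.Setoid setoid

  0≤-≈0 : ∀ {x} → x ≈ 0# → 0# ≤ x
  0≤-≈0 x≈0 = ≤-resp refl (sym x≈0) (≤-refl 0#)

  0≤-+ : ∀ {x y} → 0# ≤ x → 0# ≤ y → 0# ≤ x + y
  0≤-+ {x} {y} 0≤x 0≤y = ≤-trans _ _ _ 0≤y (≤-resp (+-identityˡ y) refl (≤-+ 0# x y 0≤x))

  ≤0-neg : ∀ {x} → 0# ≤ - x → x ≤ 0#
  ≤0-neg {x} 0≤-x = ≤-resp (+-identityˡ x) (-‿inverseˡ x) (≤-+ 0# (- x) x 0≤-x)

  0≤x∧0≤-x⇒x≈0 : ∀ {x} → 0# ≤ x → 0# ≤ - x → x ≈ 0#
  0≤x∧0≤-x⇒x≈0 {x} 0≤x 0≤-x = ≤-antisym x 0# (≤0-neg 0≤-x) 0≤x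

  0≰-1 : ¬ (0# ≤ - 1#)
  0≰-1 0≤-1 = 0≉1 (≤-antisym 0# 1# 0≤1 (≤0-neg 0≤-1))

  ι-suc-torsionFree : ∀ k {x} → ι (+ suc k) * x ≈ 0# → x ≈ 0#
  ι-suc-torsionFree k {x} kx≈0 = 0≤x∧0≤-x⇒x≈0
    (torsion k x (0≤-≈0 (trans (rep-ι k x) kx≈0)))
    (torsion k (- x) (0≤-≈0 (begin
      rep _+_ k (- x)       ≈⟨ rep-ι k (- x) ⟩
      ι (+ suc k) * - x     ≈⟨ -‿distribʳ-* _ _ ⟨
      - (ι (+ suc k) * x)   ≈⟨ -‿cong kx≈0 ⟩
      - 0#                  ≈⟨ -0#≈0# ⟩
      0#                    ∎)))

  ι-suc-*-cancelˡ : ∀ k {x y} → ι (+ suc k) * x ≈ ι (+ suc k) * y → x ≈ y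
  ι-suc-*-cancelˡ k {x} {y} kx≈ky = x∙y⁻¹≈ε⇒x≈y x y
    (ι-suc-torsionFree k (trans (x[y-z]≈xy-xz _ x y) (x≈y⇒x∙y⁻¹≈ε kx≈ky)))

  0≤ι* : ∀ n {x} → 0# ≤ x → 0# ≤ ι (+ n) * x
  0≤ι* zero    {x} _   = 0≤-≈0 (solve 1 (λ x → :c (+ 0) :* x := :c (+ 0)) refl x)
  0≤ι* (suc n) {x} 0≤x = ≤-resp refl (sym (ι-suc-* n x)) (0≤-+ 0≤x (0≤ι* n 0≤x))

  int≡ι : ∀ z → int z ≡ ι z
  int≡ι (+ n)    = nat≡ n
    where
    nat≡ : ∀ n → nat n ≡ ι (+ n)
    nat≡ zero    = ≡.refl
    nat≡ (suc n) = ≡.cong (λ x → 1# + x) (nat≡ n)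
  int≡ι -[1+ n ] = ≡.cong neg (int≡ι (+ suc n))

  inv-suc : ∀ k → ι (+ suc k) * inv (suc k) ≈ 1#
  inv-suc k = trans (sym (rep-ι k _)) (proj₂ (divisible k))

  rat-fromℤ : ∀ z → rat (fromℤ z) ≈ ι z
  rat-fromℤ z = begin
    int z * inv 1   ≡⟨ ≡.cong (_* inv 1) (int≡ι z) ⟩
    ι z * inv 1     ≈⟨ *-congˡ (proj₂ (divisible 0)) ⟩
    ι z * 1#        ≈⟨ *-idʳ (ι z) ⟩
    ι z             ∎

  ι↧*rat : ∀ q → ι (↧ q) * rat q ≈ ι (↥ q)
  ι↧*rat (mkℚ n d _) = begin
    ι (+ suc d) * (int n * inv (suc d))  ≡⟨ ≡.cong (λ i → ι (+ suc d) * (i * inv (suc d))) (int≡ι n) ⟩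
    ι (+ suc d) * (ι n * inv (suc d))    ≈⟨ solve 3 (λ a b c → a :* (b :* c) := b :* (a :* c)) refl _ _ _ ⟩
    ι n * (ι (+ suc d) * inv (suc d))    ≈⟨ *-congˡ (inv-suc d) ⟩
    ι n * 1#                             ≈⟨ *-idʳ (ι n) ⟩
    ι n                                  ∎

  rat-unique : ∀ q s {x} → ℚ.toℚᵘ q ℚᵘ.≃ s → ι (ℚᵘ.↧ s) * x ≈ ι (ℚᵘ.↥ s) → x ≈ rat q
  rat-unique q@(mkℚ m d _) (ℚᵘ.mkℚᵘ n k) {x} (ℚᵘ.*≡* cross) kx≈n =
    ι-suc-*-cancelˡ d (ι-suc-*-cancelˡ k (begin
      ι (+ suc k) * (ι (+ suc d) * x)     ≈⟨ solve 3 (λ a b c → a :* (b :* c) := (a :* c) :* b) refl _ _ _ ⟩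
      (ι (+ suc k) * x) * ι (+ suc d)     ≈⟨ *-congʳ kx≈n ⟩
      ι n * ι (+ suc d)                   ≈⟨ ι-* n (+ suc d) ⟨
      ι (n ℤ.* + suc d)                   ≡⟨ ≡.cong ι cross ⟨
      ι (m ℤ.* + suc k)                   ≈⟨ ι-* m (+ suc k) ⟩
      ι m * ι (+ suc k)                   ≈⟨ *-congʳ (ι↧*rat q) ⟨
      (ι (+ suc d) * rat q) * ι (+ suc k) ≈⟨ solve 3 (λ a b c → (a :* b) :* c := c :* (a :* b)) refl _ _ _ ⟩
      ι (+ suc k) * (ι (+ suc d) * rat q) ∎))

  rat-+ : ∀ a b → rat (a ℚ.+ b) ≈ rat a + rat b
  rat-+ a@(mkℚ na da _) b@(mkℚ nb db _) = sym (rat-unique (a ℚ.+ b) _ (ℚ.toℚᵘ-homo-+ a b) (begin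
    ι (+ suc da ℤ.* + suc db) * (rat a + rat b)  ≈⟨ *-congʳ (ι-* (+ suc da) (+ suc db)) ⟩
    (A * B) * (rat a + rat b)                    ≈⟨ solve 4 (λ A B x y → (A :* B) :* (x :+ y) := (A :* x) :* B :+ (B :* y) :* A)
                                                      refl A B (rat a) (rat b) ⟩
    (A * rat a) * B + (B * rat b) * A            ≈⟨ +-cong (*-congʳ (ι↧*rat a)) (*-congʳ (ι↧*rat b)) ⟩
    ι na * B + ι nb * A                          ≈⟨ +-cong (ι-* na (+ suc db)) (ι-* nb (+ suc da)) ⟨
    ι (na ℤ.* + suc db) + ι (nb ℤ.* + suc da)    ≈⟨ ι-+ (na ℤ.* + suc db) (nb ℤ.* + suc da) ⟨
    ι (na ℤ.* + suc db ℤ.+ nb ℤ.* + suc da)      ∎))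
    where
    A B : Carrier
    A = ι (+ suc da)
    B = ι (+ suc db)

  rat-* : ∀ a b → rat (a ℚ.* b) ≈ rat a * rat b
  rat-* a@(mkℚ na da _) b@(mkℚ nb db _) = sym (rat-unique (a ℚ.* b) _ (ℚ.toℚᵘ-homo-* a b) (begin
    ι (+ suc da ℤ.* + suc db) * (rat a * rat b)  ≈⟨ *-congʳ (ι-* (+ suc da) (+ suc db)) ⟩
    (A * B) * (rat a * rat b)                    ≈⟨ solve 4 (λ A B x y → (A :* B) :* (x :* y) := (A :* x) :* (B :* y))
                                                      refl A B (rat a) (rat b) ⟩
    (A * rat a) * (B * rat b)                    ≈⟨ *-cong (ι↧*rat a) (ι↧*rat b) ⟩
    ι na * ι nb                                  ≈⟨ ι-* na nb ⟨
    ι (na ℤ.* nb)                                ∎))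
    where
    A B : Carrier
    A = ι (+ suc da)
    B = ι (+ suc db)

  rat-0 : rat 0ℚ ≈ 0#
  rat-0 = rat-fromℤ (+ 0)

  rat-1 : rat 1ℚ ≈ 1#
  rat-1 = trans (rat-fromℤ (+ 1)) (+-idʳ 1#)

  0≤rat* : ∀ a {x} → 0ℚ ℚ.≤ a → 0# ≤ x → 0# ≤ rat a * x
  0≤rat* a@(mkℚ (+ n) d _) {x} _ 0≤x = torsion d (rat a * x) (≤-resp refl (sym (begin
    rep _+_ d (rat a * x)        ≈⟨ rep-ι d (rat a * x) ⟩
    ι (+ suc d) * (rat a * x)    ≈⟨ *-assoc _ _ _ ⟨
    (ι (+ suc d) * rat a) * x    ≈⟨ *-congʳ (ι↧*rat a) ⟩
    ι (+ n) * x                  ∎)) (0≤ι* n 0≤x))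
  0≤rat* (mkℚ -[1+ n ] d _) (ℚ.*≤* ())

  module _ {Y : Set} (ρ : Y → Carrier) where

    ⟦⊝⟧ : ∀ p → ⟦ ⊝ p ⟧ ρ ≈ - ⟦ p ⟧ ρ
    ⟦⊝⟧ p = trans (*-congʳ (rat-fromℤ -[1+ 0 ])) (solve 1 (λ x → :c -[1+ 0 ] :* x := :- x) refl (⟦ p ⟧ ρ))

    ⟦⟧-cong : ∀ {p q} → p ≈ₚ q → ⟦ p ⟧ ρ ≈ ⟦ q ⟧ ρ
    ⟦⟧-cong ≈-refl              = refl
    ⟦⟧-cong (≈-sym p≈q)         = sym (⟦⟧-cong p≈q)
    ⟦⟧-cong (≈-trans p≈q q≈r)   = trans (⟦⟧-cong p≈q) (⟦⟧-cong q≈r)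
    ⟦⟧-cong (⊕-congₚ p≈p′ q≈q′) = +-cong (⟦⟧-cong p≈p′) (⟦⟧-cong q≈q′)
    ⟦⟧-cong (⊗-congₚ p≈p′ q≈q′) = *-cong (⟦⟧-cong p≈p′) (⟦⟧-cong q≈q′)
    ⟦⟧-cong (⊕-assocₚ p q r)    = +-assoc _ _ _
    ⟦⟧-cong (⊕-commₚ p q)       = +-comm _ _
    ⟦⟧-cong (⊕-idʳₚ p)          = trans (+-congˡ rat-0) (+-idʳ _)
    ⟦⟧-cong (⊕-invʳₚ p)         = trans (+-congˡ (⟦⊝⟧ p)) (trans (proj₂ (+-inv _)) (sym rat-0))
    ⟦⟧-cong (⊗-assocₚ p q r)    = *-assoc _ _ _
    ⟦⟧-cong (⊗-commₚ p q)       = *-comm _ _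
    ⟦⟧-cong (⊗-idʳₚ p)          = trans (*-congˡ rat-1) (*-idʳ _)
    ⟦⟧-cong (distribʳₚ p q r)   = distribʳ _ _ _
    ⟦⟧-cong (con-+ a b)         = rat-+ a b
    ⟦⟧-cong (con-* a b)         = rat-* a b

    NonNeg : Pred Y
    NonNeg p = 0# ≤ ⟦ p ⟧ ρ

    Units-NonNeg⇒≈0 : ∀ p → Units NonNeg p → ⟦ p ⟧ ρ ≈ 0#
    Units-NonNeg⇒≈0 p (0≤p , 0≤⊝p) = 0≤x∧0≤-x⇒x≈0 0≤p (≤-resp refl (⟦⊝⟧ p) 0≤⊝p)

    ≈0⇒Units-NonNeg : ∀ p → ⟦ p ⟧ ρ ≈ 0# → Units NonNeg p
    ≈0⇒Units-NonNeg p p≈0 = 0≤-≈0 p≈0 , 0≤-≈0 (trans (⟦⊝⟧ p) (trans (-‿cong p≈0) -0#≈0#))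

    NonNeg-isRegularCone : IsRegularCone NonNeg
    NonNeg-isRegularCone = record
      { isCone = record
        { respects = λ p≈q → ≤-resp refl (⟦⟧-cong p≈q)
        ; zero∈    = 0≤-≈0 rat-0
        ; +-closed = λ _ _ → 0≤-+
        ; scale    = λ a _ → 0≤rat* a
        }
      ; one∈ = ≤-resp refl (sym rat-1) 0≤1
      ; units-ideal = record
        { respects = λ {p} {q} p≈q u →
            ≈0⇒Units-NonNeg q (trans (sym (⟦⟧-cong p≈q)) (Units-NonNeg⇒≈0 p u))
        ; zero∈    = ≈0⇒Units-NonNeg (con 0ℚ) rat-0
        ; +-closed = λ p q u v → ≈0⇒Units-NonNeg (p ⊕ q)
            (trans (+-cong (Units-NonNeg⇒≈0 p u) (Units-NonNeg⇒≈0 q v)) (+-idʳ 0#))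
        ; *-closed = λ r p u → ≈0⇒Units-NonNeg (r ⊗ p) (trans (*-congˡ (Units-NonNeg⇒≈0 p u)) (zeroʳ _))
        }
      }

    ¬NonNeg-1 : ¬ NonNeg (⊝ con 1ℚ)
    ¬NonNeg-1 0≤-1 = 0≰-1 (≤-resp refl (trans (⟦⊝⟧ (con 1ℚ)) (-‿cong rat-1)) 0≤-1)

    leastRegularCone⊆NonNeg : ∀ {P C} → IsLeastRegularConeContaining P C → All NonNeg P → C ⊆ NonNeg
    leastRegularCone⊆NonNeg C-least 0≤P =
      IsLeastRegularConeContaining.least C-least NonNeg NonNeg-isRegularCone (λ _ → All.lookup 0≤P)

module PolynomialRing (Y : Set) where

  commutativeRing : CommutativeRing 0ℓ 0ℓ
  commutativeRing = record
    { Carrier = Poly Y ; _≈_ = _≈ₚ_ ; _+_ = _⊕_ ; _*_ = _⊗_ ; -_ = ⊝_ ; 0# = con 0ℚ ; 1# = con 1ℚ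
    ; isCommutativeRing = IsCommutativeRingʳ.isCommutativeRing {_≈_ = _≈ₚ_} (record
      { isEquivalence = record { refl = ≈-refl ; sym = ≈-sym ; trans = ≈-trans }
      ; +-cong = ⊕-congₚ ; *-cong = ⊗-congₚ
      ; +-assoc = ⊕-assocₚ ; +-comm = ⊕-commₚ ; +-identityʳ = ⊕-idʳₚ ; -‿inverseʳ = ⊕-invʳₚ
      ; *-assoc = ⊗-assocₚ ; *-comm = ⊗-commₚ ; *-identityʳ = ⊗-idʳₚ
      ; distribʳ = λ r p q → distribʳₚ p q r }) }

  open IntegerCast commutativeRing public
  open import Relation.Binary.Reasoning.Setoid (CommutativeRing.setoid commutativeRing)

  con-cong : ∀ {a b} → a ≡ b → con {Y} a ≈ₚ con b
  con-cong ≡.refl = ≈-refl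

  ι≈con : ∀ z → ι z ≈ₚ con (fromℤ z)
  ι≈con (+ n)     = ι≈con⁺ n
    where
    ι≈con⁺ : ∀ n → ι (+ n) ≈ₚ con (fromℤ (+ n))
    ι≈con⁺ zero    = ≈-refl
    ι≈con⁺ (suc n) = begin
      con 1ℚ ⊕ ι (+ n)                ≈⟨ ⊕-congₚ ≈-refl (ι≈con⁺ n) ⟩
      con 1ℚ ⊕ con (fromℤ (+ n))      ≈⟨ con-+ 1ℚ (fromℤ (+ n)) ⟨
      con (1ℚ ℚ.+ fromℤ (+ n))        ≈⟨ con-cong (fromℤ-suc n) ⟩
      con (fromℤ (+ suc n))           ∎
  ι≈con -[1+ n ]  = begin
    ⊝ ι (+ suc n)                        ≈⟨ ⊗-congₚ ≈-refl (ι≈con (+ suc n)) ⟩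
    con (ℚ.- 1ℚ) ⊗ con (fromℤ (+ suc n)) ≈⟨ con-* (ℚ.- 1ℚ) (fromℤ (+ suc n)) ⟨
    con (ℚ.- 1ℚ ℚ.* fromℤ (+ suc n))     ≈⟨ con-cong (-1*fromℤ n) ⟩
    con (fromℤ -[1+ n ])                 ∎

  ι↧⊗con : ∀ q → ι (↧ q) ⊗ con q ≈ₚ ι (↥ q)
  ι↧⊗con q = begin
    ι (↧ q) ⊗ con q               ≈⟨ ⊗-congₚ (ι≈con (↧ q)) ≈-refl ⟩
    con (fromℤ (↧ q)) ⊗ con q     ≈⟨ con-* (fromℤ (↧ q)) q ⟨
    con (fromℤ (↧ q) ℚ.* q)       ≈⟨ con-cong (fromℤ-↧ q) ⟩
    con (fromℤ (↥ q))             ≈⟨ ι≈con (↥ q) ⟨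
    ι (↥ q)                       ∎

module ConeModel {Y : Set} (C : Pred Y) (C-regular : IsRegularCone C) (-1∉C : ¬ C (⊝ con 1ℚ)) where
  open PolynomialRing Y
  open IsRegularCone C-regular
  open IsCone isCone
  private module Units-C = IsIdeal units-ideal

  infix 4 _≤C_ _≈C_

  _≤C_ : Rel (Poly Y) 0ℓ
  x ≤C y = C (y ⊕ ⊝ x)

  _≈C_ : Rel (Poly Y) 0ℓ
  x ≈C y = x ≤C y × y ≤C x

  ≤C-refl : ∀ x → x ≤C x
  ≤C-refl x = respects (≈-sym (⊕-invʳₚ x)) zero∈

  ≤C-trans : ∀ x y z → x ≤C y → y ≤C z → x ≤C z
  ≤C-trans x y z x≤y y≤z =
    respects (solve 3 (λ x y z → (z :- y) :+ (y :- x) := z :- x) ≈-refl x y z) (+-closed _ _ y≤z x≤y)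

  ≈C-isEquivalence : IsEquivalence _≈C_
  ≈C-isEquivalence = record
    { refl  = λ {x} → ≤C-refl x , ≤C-refl x
    ; sym   = λ (x≤y , y≤x) → y≤x , x≤y
    ; trans = λ {x} {y} {z} (x≤y , y≤x) (y≤z , z≤y) → ≤C-trans x y z x≤y y≤z , ≤C-trans z y x z≤y y≤x
    }

  ≈ₚ⇒≈C : ∀ {x y} → x ≈ₚ y → x ≈C y
  ≈ₚ⇒≈C {x} {y} x≈y = respects (⊕-congₚ x≈y ≈-refl) (≤C-refl x) , respects (⊕-congₚ (≈-sym x≈y) ≈-refl) (≤C-refl y)

  ≈C⇒Units : ∀ {x y} → x ≈C y → Units C (x ⊕ ⊝ y)
  ≈C⇒Units {x} {y} (x≤y , y≤x) = y≤x , respects (solve 2 (λ x y → y :- x := :- (x :- y)) ≈-refl x y) x≤y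

  Units⇒≈C : ∀ {x y} → Units C (x ⊕ ⊝ y) → x ≈C y
  Units⇒≈C {x} {y} (y≤x , ⊝[x-y]∈C) = respects (solve 2 (λ x y → :- (x :- y) := y :- x) ≈-refl x y) ⊝[x-y]∈C , y≤x

  ⊕-congC : ∀ {x x′ y y′} → x ≈C x′ → y ≈C y′ → x ⊕ y ≈C x′ ⊕ y′
  ⊕-congC {x} {x′} {y} {y′} x≈x′ y≈y′ = Units⇒≈C (Units-C.respects
    (solve 4 (λ x x′ y y′ → (x :- x′) :+ (y :- y′) := (x :+ y) :- (x′ :+ y′)) ≈-refl x x′ y y′)
    (Units-C.+-closed _ _ (≈C⇒Units x≈x′) (≈C⇒Units y≈y′)))

  -- The only place where regularity of C is needed: units must absorb multiplication.
  ⊗-congC : ∀ {x x′ y y′} → x ≈C x′ → y ≈C y′ → x ⊗ y ≈C x′ ⊗ y′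
  ⊗-congC {x} {x′} {y} {y′} x≈x′ y≈y′ = Units⇒≈C (Units-C.respects
    (solve 4 (λ x x′ y y′ → x :* (y :- y′) :+ y′ :* (x :- x′) := x :* y :- x′ :* y′) ≈-refl x x′ y y′)
    (Units-C.+-closed _ _ (Units-C.*-closed x _ (≈C⇒Units y≈y′)) (Units-C.*-closed y′ _ (≈C⇒Units x≈x′))))

  ≤C-resp : ∀ {x x′ y y′} → x ≈C x′ → y ≈C y′ → x ≤C y → x′ ≤C y′
  ≤C-resp {x} {x′} {y} {y′} (_ , x′≤x) (y≤y′ , _) x≤y = ≤C-trans x′ x y′ x′≤x (≤C-trans x y y′ x≤y y≤y′)

  ≤C-+ : ∀ x y z → x ≤C y → x ⊕ z ≤C y ⊕ z
  ≤C-+ x y z = respects (solve 3 (λ x y z → y :- x := (y :+ z) :- (x :+ z)) ≈-refl x y z)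

  0≤C⇒∈ : ∀ {p} → con 0ℚ ≤C p → C p
  0≤C⇒∈ {p} = respects (solve 1 (λ p → p :- :c (+ 0) := p) ≈-refl p)

  ∈⇒0≤C : ∀ {p} → C p → con 0ℚ ≤C p
  ∈⇒0≤C {p} = respects (solve 1 (λ p → p := p :- :c (+ 0)) ≈-refl p)

  0≈C⇒Units : ∀ {p} → con 0ℚ ≈C p → Units C p
  0≈C⇒Units {p} (0≤p , p≤0) = 0≤C⇒∈ 0≤p , respects (solve 1 (λ p → :c (+ 0) :- p := :- p) ≈-refl p) p≤0

  1/suc : ℕ → ℚ
  1/suc k = ℚ.1/ fromℤ (+ suc k)

  1/suc⊗ι : ∀ k x → con (1/suc k) ⊗ (ι (+ suc k) ⊗ x) ≈ₚ x
  1/suc⊗ι k x = ≈-trans (solve 3 (λ q n x → q :* (n :* x) := (n :* q) :* x) ≈-refl _ _ x)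
    (≈-trans (⊗-congₚ (ι↧⊗con (1/suc k)) ≈-refl) (solve 1 (λ x → :c (+ 1) :* x := x) ≈-refl x))

  coneModel : LRRModel
  coneModel = record
    { Carrier = Poly Y ; _≈_ = _≈C_ ; _+_ = _⊕_ ; _*_ = _⊗_ ; 0# = con 0ℚ ; 1# = con 1ℚ ; _≤_ = _≤C_
    ; isEquivalence = ≈C-isEquivalence
    ; +-cong    = ⊕-congC
    ; *-cong    = ⊗-congC
    ; ≤-resp    = ≤C-resp
    ; +-assoc   = λ x y z → ≈ₚ⇒≈C (⊕-assocₚ x y z)
    ; +-comm    = λ x y → ≈ₚ⇒≈C (⊕-commₚ x y)
    ; +-idʳ     = λ x → ≈ₚ⇒≈C (⊕-idʳₚ x)
    ; +-inv     = λ x → ⊝ x , ≈ₚ⇒≈C (⊕-invʳₚ x)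
    ; *-assoc   = λ x y z → ≈ₚ⇒≈C (⊗-assocₚ x y z)
    ; *-comm    = λ x y → ≈ₚ⇒≈C (⊗-commₚ x y)
    ; *-idʳ     = λ x → ≈ₚ⇒≈C (⊗-idʳₚ x)
    ; distribʳ  = λ x y z → ≈ₚ⇒≈C (distribʳₚ x y z)
    ; ≤-refl    = ≤C-refl
    ; ≤-trans   = ≤C-trans
    ; ≤-antisym = λ _ _ x≤y y≤x → x≤y , y≤x
    ; ≤-+       = ≤C-+
    ; 0≤1       = ∈⇒0≤C one∈
    ; 0≉1       = λ (_ , 1≤0) → -1∉C (respects (solve 1 (λ o → :c (+ 0) :- o := :- o) ≈-refl (con 1ℚ)) 1≤0)
    ; divisible = λ k → con (1/suc k) , ≈ₚ⇒≈C (≈-trans (rep-ι k _) (≈-trans (ι↧⊗con (1/suc k)) (⊕-idʳₚ _)))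
    ; torsion   = λ k x 0≤kx → ∈⇒0≤C (respects (1/suc⊗ι k x)
        (scale (1/suc k) _ (ℚ.*≤* (ℤ.+≤+ ℕ.z≤n)) (respects (rep-ι k x) (0≤C⇒∈ 0≤kx))))
    }

  private module Theory = LRRModelTheory coneModel
  open Eval coneModel using (⟦_⟧)
  open IsEquivalence ≈C-isEquivalence using () renaming (refl to ≈C-refl; sym to ≈C-sym)

  ι≡Theory-ι : ∀ z → Theory.ι z ≡ ι z
  ι≡Theory-ι (+ n)    = ι≡⁺ n
    where
    ι≡⁺ : ∀ n → Theory.ι (+ n) ≡ ι (+ n)
    ι≡⁺ zero    = ≡.refl
    ι≡⁺ (suc n) = ≡.cong (con 1ℚ ⊕_) (ι≡⁺ n)
  ι≡Theory-ι -[1+ n ] = ≡.cong ⊝_ (ι≡Theory-ι (+ suc n))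

  ⟦⟧-var : ∀ p → ⟦ p ⟧ var ≈C p
  ⟦⟧-var (con a@(mkℚ n _ _)) = ≈C-sym (Theory.rat-unique a (ℚ.toℚᵘ a) ℚᵘ.≃-refl ι↧⊗con-C)
    where
    ι↧⊗con-C : Theory.ι (↧ a) ⊗ con a ≈C Theory.ι n
    ι↧⊗con-C rewrite ι≡Theory-ι (↧ a) | ι≡Theory-ι n = ≈ₚ⇒≈C (ι↧⊗con a)
  ⟦⟧-var (var y) = ≈C-refl
  ⟦⟧-var (p ⊕ q) = ⊕-congC (⟦⟧-var p) (⟦⟧-var q)
  ⟦⟧-var (p ⊗ q) = ⊗-congC (⟦⟧-var p) (⟦⟧-var q)

  0≤⟦⟧⇒∈ : ∀ p → con 0ℚ ≤C ⟦ p ⟧ var → C p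
  0≤⟦⟧⇒∈ p 0≤p = 0≤C⇒∈ (≤C-resp ≈C-refl (⟦⟧-var p) 0≤p)

  ∈⇒0≤⟦⟧ : ∀ p → C p → con 0ℚ ≤C ⟦ p ⟧ var
  ∈⇒0≤⟦⟧ p p∈C = ≤C-resp ≈C-refl (≈C-sym (⟦⟧-var p)) (∈⇒0≤C p∈C)

  0≈⟦⟧⇒Units : ∀ p → con 0ℚ ≈C ⟦ p ⟧ var → Units C p
  0≈⟦⟧⇒Units p 0≈p = 0≈C⇒Units (IsEquivalence.trans ≈C-isEquivalence 0≈p (⟦⟧-var p))

module _ {Y : Set} {P Q R : List (Poly Y)} {C : Pred Y} (C-least : IsLeastRegularConeContaining P C) where
  open IsLeastRegularConeContaining C-least

  leastRegularCone⊆Cn : ∀ p → C p → Cn (formula P Q R) p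
  leastRegularCone⊆Cn p p∈C M ρ (0≤P , _) = LRRModelTheory.leastRegularCone⊆NonNeg M ρ C-least 0≤P p p∈C

  Cn⊆leastRegularCone : Satisfiable (formula P Q R) → ∀ p → Cn (formula P Q R) p → C p
  Cn⊆leastRegularCone (M , ρ , 0≤P , Q≱0 , R≉0) p F⊨0≤p = 0≤⟦⟧⇒∈ p (F⊨0≤p coneModel var var-sat)
    where
    open LRRModelTheory M using (NonNeg; ¬NonNeg-1; Units-NonNeg⇒≈0; leastRegularCone⊆NonNeg; sym)

    C⊆NonNeg : C ⊆ NonNeg ρ
    C⊆NonNeg = leastRegularCone⊆NonNeg ρ C-least 0≤P

    -1∉C : ¬ C (⊝ con 1ℚ)
    -1∉C -1∈C = ¬NonNeg-1 ρ (C⊆NonNeg _ -1∈C)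

    open ConeModel C regular -1∉C

    var-sat : Sat coneModel var (formula P Q R)
    var-sat = All.tabulate (λ {p} p∈P → ∈⇒0≤⟦⟧ p (contains p p∈P))
            , All.tabulate (λ {q} q∈Q 0≤q → All.lookup Q≱0 q∈Q (C⊆NonNeg q (0≤⟦⟧⇒∈ q 0≤q)))
            , All.tabulate (λ {r} r∈R 0≈r → All.lookup R≉0 r∈R
                (sym (Units-NonNeg⇒≈0 ρ r (map (C⊆NonNeg r) (C⊆NonNeg (⊝ r)) (0≈⟦⟧⇒Units r 0≈r)))))

lemma3p7 : (Y : Set) (P Q R : List (Poly Y)) (C : Poly Y → Set) →
    IsLeastRegularConeContaining P C →
    Satisfiable (formula P Q R) →
    (∀ p → (C p → Cn (formula P Q R) p) × (Cn (formula P Q R) p → C p))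
lemma3p7 Y P Q R C C-least F-sat p = leastRegularCone⊆Cn C-least p , Cn⊆leastRegularCone C-least F-sat p
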